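{- Let $n\ge3$, let $T$ be a triangulation of the convex $n$-gon and $\tau$ its dual rooted binary tree. For $i\in\{1,\dots,n-2\}$, the $i$-th coordinate of Loday's DFS-vector $\psi(\tau)$ equals $(i-h)(j-i)$, where $h<i<j$ are the vertices of the unique triangle of $T$ whose middle vertex is $i$; equivalently, it equals the area $\mathcal A_i$ of the region lying below the beam $B_i$ and inside the box $[0,i]\times[i,n-1]$.
   Context: Let $\{0,\dots,n-1\}$ be the vertices of a convex $n$-gon. The dual tree $\tau$ of a triangulation $T$ is the binary tree whose internal nodes are the $n-2$ triangles of $T$, rooted at the triangle containing $[0,n-1]$; the left (resp. right) child of the triangle with vertices $h<i<j$ is the subtree on the side of the edge $[h,i]$ (resp. $[i,j]$) not containing this triangle, a boundary edge giving a leaf. The DFS-labeling of $\tau$ labels its internal nodes $1,\dots,n-2$ so that each label exceeds all labels in its left child and is smaller than all labels in its right child. Loday's DFS-vector $\psi(\tau)\in\mathbb{R}^{n-2}$ has $i$-th coordinate the product of the numbers of leaves in the left and right children of the node labeled $i$. Beams: place a mirror at each lattice point $(u,v)$, $u<v$, with $[u,v]\in T$. For $i=1,\dots,n-2$ the beam $B_i$ starts at $(-\infty,i)$ moving rightward; a beam moving rightward along $y=v$ reaching a mirror $(u,v)$ turns upward along $x=u$, and a beam moving upward along $x=u$ reaching a mirror $(u,v)$ turns rightward along $y=v$; $B_i$ ends going to $(i,+\infty)$. -}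

module Defs where

open import Data.Nat using (ℕ; zero; suc; _+_; _*_; _∸_; _≤_; _<_; _⊓_)
open import Data.Bool using (Bool; true; false; _∧_)
open import Data.Maybe using (Maybe; just; nothing)
open import Data.List using (List; []; _∷_; _++_)
open import Data.Product using (_×_)
open import Data.Sum using (_⊎_)
open import Relation.Nullary using (¬_)
open import Relation.Binary.PropositionalEquality using (_≡_)

-- Vertices of the convex n-gon are 0,…,n-1 (as natural numbers).
-- A set of segments [u,v] (u < v) is a Boolean predicate on pairs.

Edges : Set
Edges = ℕ → ℕ → Bool

Cross : ℕ → ℕ → ℕ → ℕ → Set
Cross a c b d = (a < b × b < c × c < d) ⊎ (b < a × a < d × d < c)

-- T is a triangulation of the convex n-gon: a maximal set of pairwise
-- non-crossing segments between vertices (it thus contains the boundary edges).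
record IsTriangulation (n : ℕ) (T : Edges) : Set where
  field
    inRange  : ∀ u v → T u v ≡ true → u < v × v < n
    noCross  : ∀ a c b d → T a c ≡ true → T b d ≡ true → ¬ Cross a c b d
    maximal  : ∀ u v → u < v → v < n →
               (∀ a c → T a c ≡ true → ¬ Cross u v a c) → T u v ≡ true

Triangle : Edges → ℕ → ℕ → ℕ → Set
Triangle T h i j = h < i × i < j × T h i ≡ true × T i j ≡ true × T h j ≡ true

search : (ℕ → Bool) → ℕ → ℕ → Maybe ℕ
search P lo zero = nothing
search P lo (suc c) with P lo
... | true  = just lo
... | false = search P (suc lo) c

data Tree : Set where
  leaf : Tree
  node : Tree → Tree → Tree

-- apex of the triangle lying on the side of the edge [h,j] towards
-- the vertices h+1,…,j-1 : the vertex h<i<j with [h,i],[i,j] ∈ T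
apex : Edges → ℕ → ℕ → Maybe ℕ
apex T h j = search (λ i → T h i ∧ T i j) (suc h) (j ∸ suc h)

-- the subtree of the region cut off by [h,j] (fuel bounds the depth;
-- fuel n is always sufficient since j - h decreases)
subtree : Edges → ℕ → ℕ → ℕ → Tree
subtree T zero h j = leaf
subtree T (suc f) h j with apex T h j
... | nothing = leaf          -- [h,j] is a boundary edge: a leaf
... | just i  = node (subtree T f h i) (subtree T f i j)

-- dual tree τ of T, rooted at the triangle containing [0,n-1];
-- left child across [h,i], right child across [i,j]
dualTree : ℕ → Edges → Tree
dualTree n T = subtree T n 0 (n ∸ 1)

leaves : Tree → ℕ
leaves leaf       = 1
leaves (node l r) = leaves l + leaves r

-- Loday's DFS-vector listed in order of the DFS-labels 1,2,…:
-- the DFS-labeling (each label larger than those of the left child and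
-- smaller than those of the right child) is the in-order labeling.
dfsVector : Tree → List ℕ
dfsVector leaf       = []
dfsVector (node l r) = dfsVector l ++ (leaves l * leaves r ∷ dfsVector r)

-- 1-based coordinate access (0 outside the range)
coord : List ℕ → ℕ → ℕ
coord []       _             = 0
coord (x ∷ xs) zero          = 0
coord (x ∷ xs) (suc zero)    = x
coord (x ∷ xs) (suc (suc k)) = coord xs (suc k)

ψ : ℕ → Edges → ℕ → ℕ
ψ n T i = coord (dfsVector (dualTree n T)) i

-- Mirrors at the lattice points (u,v), u<v, [u,v] ∈ T.
-- A beam is recorded by its horizontal segments (y , xstart , xend),
-- meaning it travels rightward along y from x = xstart to x = xend.
-- A start at x = -∞ is recorded as xstart = 0 and an escape to x = +∞
-- as xend = n (only the part inside the box [0,i]×[i,n-1] matters).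

record Seg : Set where
  constructor seg
  field
    y xs xe : ℕ

mutual
  -- moving rightward along y, currently at xs, next mirror searched in [lo, y)
  goRight : ℕ → Edges → ℕ → ℕ → ℕ → ℕ → List Seg
  goRight n T zero    y xs lo = []
  goRight n T (suc f) y xs lo with search (λ u → T u y) lo (y ∸ lo)
  ... | nothing = seg y xs n ∷ []
  ... | just u  = seg y xs u ∷ goUp n T f u y

  -- moving upward along x from height y, next mirror searched in (y, n)
  goUp : ℕ → Edges → ℕ → ℕ → ℕ → List Seg
  goUp n T zero    x y = []
  goUp n T (suc f) x y with search (λ v → T x v) (suc y) (n ∸ suc y)
  ... | nothing = []            -- the beam leaves towards (x , +∞)
  ... | just v  = goRight n T f v x (suc x)

-- the beam B_i : starts at (-∞, i) moving rightward (fuel 2n suffices,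
-- each reflection strictly increases a coordinate bounded by n)
beam : ℕ → Edges → ℕ → List Seg
beam n T i = goRight n T (2 * n) i 0 0

areaBelow : ℕ → ℕ → List Seg → ℕ
areaBelow n i []               = 0
areaBelow n i (seg y xs xe ∷ s) =
  ((xe ⊓ i) ∸ xs) * ((y ⊓ (n ∸ 1)) ∸ i) + areaBelow n i s

beamArea : ℕ → Edges → ℕ → ℕ
beamArea n T i = areaBelow n i (beam n T i)

-- The dual tree of the sub-polygon cut off by a diagonal [h,j] has j − h leaves; its root
-- is the triangle h < a < j, and its in-order labels, shifted by h, are the vertices
-- h+1,…,j−1, the root being labelled a − h.  Descending along the diagonals that enclose i,
-- the node labelled i is therefore the triangle h < i < j with middle vertex i, whose
-- children have i − h and j − i leaves.  By non-crossing, the beam B_i meets the mirrors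
-- (h,i), (h,j), (i,j) in this order: inside the box it sweeps out exactly the rectangle
-- [h,i] × [i,j], after which it stays at abscissa ≥ i.
module Submission where

open import Defs
open import Data.Nat using (ℕ; _*_; _∸_; _≤_)
open import Data.Product using (_×_; ∃₂)
open import Relation.Binary.PropositionalEquality using (_≡_)

open import Data.Nat using (zero; suc; _+_; _<_; _⊓_; pred; z≤n; s≤s; z<s)
open import Data.Nat.Properties
open import Data.Bool using (Bool; true; false; _∧_)
open import Data.Bool.Properties using (∧-conicalˡ; ∧-conicalʳ; ¬-not; not-¬)
open import Data.Maybe using (just; nothing)
open import Data.List using ([]; _∷_; _++_; length)
open import Data.List.Properties using (length-++)
open import Data.Product using (Σ; ∃; _,_; proj₁; proj₂)
open import Data.Sum using (inj₁; inj₂)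
open import Data.Empty using (⊥; ⊥-elim)
open import Relation.Nullary using (¬_)
open import Relation.Binary.PropositionalEquality
  using (_≢_; refl; sym; trans; cong; cong₂; subst; module ≡-Reasoning)
open import Relation.Binary.Definitions using (Tri; tri<; tri≈; tri>)

≢true⇒≡false : ∀ {b} → b ≢ true → b ≡ false
≢true⇒≡false = ¬-not

[n∸m]+[o∸n]≡o∸m : ∀ {m n o} → m ≤ n → n ≤ o → (n ∸ m) + (o ∸ n) ≡ o ∸ m
[n∸m]+[o∸n]≡o∸m {m} {n} {o} m≤n n≤o = begin
  (n ∸ m) + (o ∸ n) ≡⟨ +-comm (n ∸ m) (o ∸ n) ⟩
  (o ∸ n) + (n ∸ m) ≡⟨ sym (+-∸-assoc (o ∸ n) m≤n) ⟩
  (o ∸ n) + n ∸ m   ≡⟨ cong (_∸ m) (m∸n+n≡m n≤o) ⟩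
  o ∸ m             ∎
  where open ≡-Reasoning

m<n<o⇒1<o∸m : ∀ {m n o} → m < n → n < o → 1 < o ∸ m
m<n<o⇒1<o∸m m<n n<o = ≤-<-trans (m<n⇒0<n∸m m<n) (∸-monoˡ-< n<o (<⇒≤ m<n))

module _ {h a j f : ℕ} (h<a : h < a) (a<j : a < j) (width : j ∸ h ≤ suc f) where

  narrowerˡ : a ∸ h ≤ f
  narrowerˡ = ≤-pred (<-≤-trans (∸-monoˡ-< a<j (<⇒≤ h<a)) width)

  narrowerʳ : j ∸ a ≤ f
  narrowerʳ = ≤-pred (<-≤-trans (∸-monoʳ-< h<a (<⇒≤ a<j)) width)

within : ∀ {lo hi m} → lo ≤ hi → m < hi → m < lo + (hi ∸ lo)
within {m = m} lo≤hi m<hi = subst (m <_) (sym (m+[n∸m]≡n lo≤hi)) m<hi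

empty-range : ∀ {lo m} → lo ≤ m → m < lo + 0 → ⊥
empty-range {lo} lo≤m m<lo = <⇒≱ m<lo (subst (_≤ _) (sym (+-identityʳ lo)) lo≤m)

module _ (P : ℕ → Bool) where

  search-sound : ∀ lo c {k} → search P lo c ≡ just k → P k ≡ true × lo ≤ k × k < lo + c
  search-sound lo zero ()
  search-sound lo (suc c) {k} e with P lo in Plo
  search-sound lo (suc c) refl | true = Plo , ≤-refl , m<m+n lo z<s
  ... | false with search-sound (suc lo) c e
  ...   | Pk , lo<k , k<1+lo+c = Pk , <⇒≤ lo<k , subst (k <_) (sym (+-suc lo c)) k<1+lo+c

  search-nothing : ∀ lo c → search P lo c ≡ nothing →
                   ∀ {m} → lo ≤ m → m < lo + c → P m ≡ false
  search-nothing lo zero _ lo≤m m<lo = ⊥-elim (empty-range lo≤m m<lo)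
  search-nothing lo (suc c) e {m} lo≤m m< with P lo in Plo
  search-nothing lo (suc c) () lo≤m m< | true
  ... | false with m≤n⇒m<n∨m≡n lo≤m
  ...   | inj₂ refl = Plo
  ...   | inj₁ lo<m = search-nothing (suc lo) c e lo<m (subst (m <_) (+-suc lo c) m<)

  search-least : ∀ lo c {k} → P k ≡ true → lo ≤ k → k < lo + c →
                 (∀ {m} → lo ≤ m → m < k → P m ≡ false) → search P lo c ≡ just k
  search-least lo zero _ lo≤k k<lo _ = ⊥-elim (empty-range lo≤k k<lo)
  search-least lo (suc c) {k} Pk lo≤k k< before with P lo in Plo | m≤n⇒m<n∨m≡n lo≤k
  ... | true  | inj₂ refl = refl
  ... | true  | inj₁ lo<k = ⊥-elim (not-¬ Plo (before ≤-refl lo<k))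
  ... | false | inj₂ refl = ⊥-elim (not-¬ Pk Plo)
  ... | false | inj₁ lo<k =
    search-least (suc lo) c Pk lo<k (subst (k <_) (+-suc lo c) k<) (λ lo<m → before (<⇒≤ lo<m))

  greatest : ∀ {lo} hi → lo < hi → P lo ≡ true →
             Σ ℕ λ k → lo ≤ k × k < hi × P k ≡ true × (∀ {m} → k < m → m < hi → P m ≡ false)
  greatest (suc hi) lo<1+hi Plo with P hi in Phi | m<1+n⇒m<n∨m≡n lo<1+hi
  ... | true  | _ = hi , ≤-pred lo<1+hi , ≤-refl , Phi ,
                    λ hi<m m<1+hi → ⊥-elim (<⇒≱ hi<m (≤-pred m<1+hi))
  ... | false | inj₂ refl = ⊥-elim (not-¬ Plo Phi)
  ... | false | inj₁ lo<hi with greatest hi lo<hi Plo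
  ...   | k , lo≤k , k<hi , Pk , after = k , lo≤k , m<n⇒m<1+n k<hi , Pk , after′
    where
    after′ : ∀ {m} → k < m → m < suc hi → P m ≡ false
    after′ k<m m<1+hi with m<1+n⇒m<n∨m≡n m<1+hi
    ... | inj₁ m<hi = after k<m m<hi
    ... | inj₂ refl = Phi

coord-++ˡ : ∀ xs ys {k} → k ≤ length xs → coord (xs ++ ys) k ≡ coord xs k
coord-++ˡ []       []       z≤n = refl
coord-++ˡ []       (_ ∷ _)  z≤n = refl
coord-++ˡ (_ ∷ _)  _ {zero}        _         = refl
coord-++ˡ (_ ∷ _)  _ {suc zero}    _         = refl
coord-++ˡ (_ ∷ xs) ys {suc (suc k)} (s≤s k≤) = coord-++ˡ xs ys k≤

coord-++-∷ : ∀ xs y ys → coord (xs ++ y ∷ ys) (suc (length xs)) ≡ y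
coord-++-∷ []       y ys = refl
coord-++-∷ (_ ∷ xs) y ys = coord-++-∷ xs y ys

coord-++-∷ʳ : ∀ xs y ys {k} → 0 < k → coord (xs ++ y ∷ ys) (suc (length xs) + k) ≡ coord ys k
coord-++-∷ʳ []       y ys {suc k} _ = refl
coord-++-∷ʳ (_ ∷ xs) y ys       0<k = coord-++-∷ʳ xs y ys 0<k

suc-length-dfsVector : ∀ t → suc (length (dfsVector t)) ≡ leaves t
suc-length-dfsVector leaf = refl
suc-length-dfsVector (node l r) rewrite length-++ (dfsVector l) {leaves l * leaves r ∷ dfsVector r}
  | sym (suc-length-dfsVector l) | sym (suc-length-dfsVector r) = refl

module _ (l r : Tree) {h a : ℕ} (h≤a : h ≤ a) (leaves-l : leaves l ≡ a ∸ h) where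

  private
    suc-length-l : suc (length (dfsVector l)) ≡ a ∸ h
    suc-length-l = trans (suc-length-dfsVector l) leaves-l

  coord-dfsVector-left : ∀ {i} → h ≤ i → i < a →
                         coord (dfsVector (node l r)) (i ∸ h) ≡ coord (dfsVector l) (i ∸ h)
  coord-dfsVector-left {i} h≤i i<a =
    coord-++ˡ (dfsVector l) _ (≤-pred (subst (i ∸ h <_) (sym suc-length-l) (∸-monoˡ-< i<a h≤i)))

  coord-dfsVector-root : coord (dfsVector (node l r)) (a ∸ h) ≡ leaves l * leaves r
  coord-dfsVector-root =
    subst (λ k → coord (dfsVector (node l r)) k ≡ leaves l * leaves r)
          suc-length-l (coord-++-∷ (dfsVector l) _ (dfsVector r))

  coord-dfsVector-right : ∀ {i} → a < i →
                          coord (dfsVector (node l r)) (i ∸ h) ≡ coord (dfsVector r) (i ∸ a)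
  coord-dfsVector-right {i} a<i = begin
    coord (dfsVector (node l r)) (i ∸ h)
      ≡⟨ cong (coord (dfsVector (node l r))) (sym ([n∸m]+[o∸n]≡o∸m h≤a (<⇒≤ a<i))) ⟩
    coord (dfsVector (node l r)) ((a ∸ h) + (i ∸ a))
      ≡⟨ cong (λ s → coord (dfsVector (node l r)) (s + (i ∸ a))) (sym suc-length-l) ⟩
    coord (dfsVector (node l r)) (suc (length (dfsVector l)) + (i ∸ a))
      ≡⟨ coord-++-∷ʳ (dfsVector l) _ (dfsVector r) (m<n⇒0<n∸m a<i) ⟩
    coord (dfsVector r) (i ∸ a) ∎
    where open ≡-Reasoning

module _ {n : ℕ} {T : Edges} where

  goRight-reflects : ∀ f {y xs lo u} → search (λ u → T u y) lo (y ∸ lo) ≡ just u →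
                     goRight n T (suc f) y xs lo ≡ seg y xs u ∷ goUp n T f u y
  goRight-reflects f e rewrite e = refl

  goUp-reflects : ∀ f {x y v} → search (λ v → T x v) (suc y) (n ∸ suc y) ≡ just v →
                  goUp n T (suc f) x y ≡ goRight n T f v x (suc x)
  goUp-reflects f e rewrite e = refl

  areaBelow-∷-beyond : ∀ {i y xs xe} s → i ≤ xs →
                       areaBelow n i (seg y xs xe ∷ s) ≡ areaBelow n i s
  areaBelow-∷-beyond {i} {y} {xs} {xe} s i≤xs =
    cong (λ w → w * ((y ⊓ (n ∸ 1)) ∸ i) + areaBelow n i s)
         (m≤n⇒m∸n≡0 (≤-trans (m⊓n≤n xe i) i≤xs))

  mutual
    areaBelow-goRight-beyond : ∀ f {i y xs lo} → i ≤ xs → xs ≤ lo →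
                               areaBelow n i (goRight n T f y xs lo) ≡ 0
    areaBelow-goRight-beyond zero _ _ = refl
    areaBelow-goRight-beyond (suc f) {i} {y} {xs} {lo} i≤xs xs≤lo
      with search (λ u → T u y) lo (y ∸ lo) in e
    ... | nothing = areaBelow-∷-beyond [] i≤xs
    ... | just u  = trans (areaBelow-∷-beyond (goUp n T f u y) i≤xs)
                          (areaBelow-goUp-beyond f (≤-trans i≤xs (≤-trans xs≤lo lo≤u)))
      where
      lo≤u : lo ≤ u
      lo≤u = proj₁ (proj₂ (search-sound _ lo (y ∸ lo) e))

    areaBelow-goUp-beyond : ∀ f {i x y} → i ≤ x → areaBelow n i (goUp n T f x y) ≡ 0
    areaBelow-goUp-beyond zero _ = refl
    areaBelow-goUp-beyond (suc f) {i} {x} {y} i≤x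
      with search (λ v → T x v) (suc y) (n ∸ suc y)
    ... | nothing = refl
    ... | just v  = areaBelow-goRight-beyond f i≤x (n≤1+n x)

module TriangulationProperties {n : ℕ} {T : Edges} (tr : IsTriangulation n T) where
  open IsTriangulation tr

  edge<n : ∀ {u v} → T u v ≡ true → v < n
  edge<n {u} {v} Tuv = proj₂ (inRange u v Tuv)

  no-interleaving : ∀ {a b c d} → T a c ≡ true → T b d ≡ true → a < b → b < c → c < d → ⊥
  no-interleaving {a} {b} {c} {d} Tac Tbd a<b b<c c<d = noCross a c b d Tac Tbd (inj₁ (a<b , b<c , c<d))

  ends-within : ∀ {a b c d} → T a c ≡ true → T b d ≡ true → a < b → b < c → d ≤ c
  ends-within Tac Tbd a<b b<c = ≮⇒≥ (no-interleaving Tac Tbd a<b b<c)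

  starts-within : ∀ {a b c d} → T a c ≡ true → T b d ≡ true → b < c → c < d → b ≤ a
  starts-within Tac Tbd b<c c<d = ≮⇒≥ (λ a<b → no-interleaving Tac Tbd a<b b<c c<d)

  boundaryEdge : ∀ {k} → suc k < n → T k (suc k) ≡ true
  boundaryEdge {k} 1+k<n = maximal k (suc k) ≤-refl 1+k<n uncrossed
    where
    uncrossed : ∀ a c → T a c ≡ true → ¬ Cross k (suc k) a c
    uncrossed _ _ _ (inj₁ (k<a , a<1+k , _)) = <⇒≱ k<a (≤-pred a<1+k)
    uncrossed _ _ _ (inj₂ (_ , k<c , c<1+k)) = <⇒≱ k<c (≤-pred c<1+k)

  outerEdge : 1 < n → T 0 (pred n) ≡ true
  outerEdge 1<n = maximal 0 (pred n) (<⇒≤pred 1<n) (∸-monoʳ-< z<s (<⇒≤ 1<n)) uncrossed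
    where
    uncrossed : ∀ a c → T a c ≡ true → ¬ Cross 0 (pred n) a c
    uncrossed _ _ Tac (inj₁ (_ , _ , pn<c)) = <⇒≱ pn<c (<⇒≤pred (edge<n Tac))
    uncrossed _ _ _   (inj₂ (() , _ , _))

  middle-unique : ∀ {h i j h′ j′} → Triangle T h i j → Triangle T h′ i j′ → h ≡ h′ × j ≡ j′
  middle-unique (h<i , i<j , Thi , Tij , Thj) (h′<i , i<j′ , Th′i , Tij′ , Th′j′) =
    ≤-antisym (starts-within Th′i Thj h<i i<j) (starts-within Thi Th′j′ h′<i i<j′) ,
    ≤-antisym (ends-within Th′j′ Tij h′<i i<j′) (ends-within Thj Tij′ h<i i<j)

  -- The apex is the last neighbour a of h before j: an edge crossing [a,j] would cross
  -- [h,j] or [h,a], or be a later neighbour of h.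
  apex-exists : ∀ {h j} → T h j ≡ true → suc h < j → ∃ λ a → Triangle T h a j
  apex-exists {h} {j} Thj 1+h<j
    with greatest (T h) j 1+h<j (boundaryEdge (<-trans 1+h<j (edge<n Thj)))
  ... | a , h<a , a<j , Tha , later = a , h<a , a<j , Tha , Taj , Thj
    where
    uncrossed : ∀ b d → T b d ≡ true → ¬ Cross a j b d
    uncrossed b d Tbd (inj₁ (a<b , b<j , j<d)) = no-interleaving Thj Tbd (<-trans h<a a<b) b<j j<d
    uncrossed b d Tbd (inj₂ (b<a , a<d , d<j)) with <-cmp b h
    ... | tri< b<h _ _ = noCross h j b d Thj Tbd (inj₂ (b<h , <-trans h<a a<d , d<j))
    ... | tri≈ _ refl _ = not-¬ Tbd (later a<d d<j)
    ... | tri> _ _ h<b = no-interleaving Tha Tbd h<b b<a a<d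
    Taj : T a j ≡ true
    Taj = maximal a j a<j (edge<n Thj) uncrossed

  apex-just : ∀ {h j a} → T h j ≡ true → apex T h j ≡ just a → Triangle T h a j
  apex-just {h} {j} {a} Thj e with search-sound (λ i → T h i ∧ T i j) (suc h) (j ∸ suc h) e
  ... | Tha∧Taj , h<a , a< =
    h<a , subst (a <_) (m+[n∸m]≡n (proj₁ (inRange h j Thj))) a< ,
    ∧-conicalˡ _ _ Tha∧Taj , ∧-conicalʳ _ _ Tha∧Taj , Thj

  apex-nothing : ∀ {h j} → T h j ≡ true → suc h < j → apex T h j ≢ nothing
  apex-nothing {h} {j} Thj 1+h<j e with apex-exists Thj 1+h<j
  ... | a , h<a , a<j , Tha , Taj , _ =
    not-¬ (cong₂ _∧_ Tha Taj)
          (search-nothing _ (suc h) (j ∸ suc h) e h<a (within (<⇒≤ 1+h<j) a<j))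

  middle-within : ∀ f {h i j} → j ∸ h ≤ suc f → T h j ≡ true → h < i → i < j →
                  ∃₂ λ h′ j′ → Triangle T h′ i j′
  middle-within zero width _ h<i i<j = ⊥-elim (<⇒≱ (m<n<o⇒1<o∸m h<i i<j) width)
  middle-within (suc f) {i = i} width Thj h<i i<j with apex-exists Thj (≤-<-trans h<i i<j)
  ... | a , t@(h<a , a<j , Tha , Taj , _) with <-cmp i a
  ...   | tri≈ _ refl _ = _ , _ , t
  ...   | tri< i<a _ _ = middle-within f (narrowerˡ h<a a<j width) Tha h<i i<a
  ...   | tri> _ _ a<i = middle-within f (narrowerʳ h<a a<j width) Taj a<i i<j

  middle-exists : ∀ {i} → 0 < i → i < pred n → ∃₂ λ h j → Triangle T h i j
  middle-exists 0<i i<pn =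
    middle-within n (≤-trans pred[n]≤n (n≤1+n n)) (outerEdge 1<n) 0<i i<pn
    where
    1<n : 1 < n
    1<n = ≤-<-trans 0<i (<-≤-trans i<pn pred[n]≤n)

  leaves-subtree : ∀ f {h j} → T h j ≡ true → j ∸ h ≤ suc f → leaves (subtree T f h j) ≡ j ∸ h
  leaves-subtree zero {h} {j} Thj width = ≤-antisym (m<n⇒0<n∸m (proj₁ (inRange h j Thj))) width
  leaves-subtree (suc f) {h} {j} Thj width with apex T h j in e
  ... | nothing with m≤n⇒m<n∨m≡n (proj₁ (inRange h j Thj))
  ...   | inj₁ 1+h<j = ⊥-elim (apex-nothing Thj 1+h<j e)
  ...   | inj₂ refl  = sym (m+n∸n≡m 1 h)
  leaves-subtree (suc f) {h} {j} Thj width | just a with apex-just Thj e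
  ... | h<a , a<j , Tha , Taj , _ = begin
    leaves (subtree T f h a) + leaves (subtree T f a j)
      ≡⟨ cong₂ _+_ (leaves-subtree f Tha (narrowerˡ h<a a<j width))
                   (leaves-subtree f Taj (narrowerʳ h<a a<j width)) ⟩
    (a ∸ h) + (j ∸ a)
      ≡⟨ [n∸m]+[o∸n]≡o∸m (<⇒≤ h<a) (<⇒≤ a<j) ⟩
    j ∸ h ∎
    where open ≡-Reasoning

  coord-dfsVector-subtree : ∀ f {h j} → T h j ≡ true → j ∸ h ≤ suc f →
    ∀ {h′ i j′} → Triangle T h′ i j′ → h ≤ h′ → j′ ≤ j →
    coord (dfsVector (subtree T f h j)) (i ∸ h) ≡ (i ∸ h′) * (j′ ∸ i)
  coord-dfsVector-subtree zero _ width (h′<i , i<j′ , _) h≤h′ j′≤j =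
    ⊥-elim (<⇒≱ (m<n<o⇒1<o∸m (≤-<-trans h≤h′ h′<i) (<-≤-trans i<j′ j′≤j)) width)
  coord-dfsVector-subtree (suc f) {h} {j} Thj width {h′} {i} {j′}
                          t@(h′<i , i<j′ , Th′i , Tij′ , _) h≤h′ j′≤j with apex T h j in e
  ... | nothing = ⊥-elim (apex-nothing Thj (≤-<-trans (≤-<-trans h≤h′ h′<i) (<-≤-trans i<j′ j′≤j)) e)
  ... | just a = byPosition (apex-just Thj e) (<-cmp i a)
    where
    h<i : h < i
    h<i = ≤-<-trans h≤h′ h′<i
    i<j : i < j
    i<j = <-≤-trans i<j′ j′≤j
    L R : Tree
    L = subtree T f h a
    R = subtree T f a j
    byPosition : Triangle T h a j → Tri (i < a) (i ≡ a) (a < i) →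
                 coord (dfsVector (node L R)) (i ∸ h) ≡ (i ∸ h′) * (j′ ∸ i)
    byPosition apexTriangle@(h<a , a<j , Tha , Taj , _) (tri≈ _ refl _)
      with middle-unique apexTriangle t
    ... | refl , refl =
      trans (coord-dfsVector-root L R (<⇒≤ h<a) leavesL) (cong₂ _*_ leavesL leavesR)
      where
      leavesL : leaves L ≡ i ∸ h
      leavesL = leaves-subtree f Tha (narrowerˡ h<a a<j width)
      leavesR : leaves R ≡ j ∸ i
      leavesR = leaves-subtree f Taj (narrowerʳ h<a a<j width)
    byPosition (h<a , a<j , Tha , Taj , _) (tri< i<a _ _) =
      trans (coord-dfsVector-left L R (<⇒≤ h<a) (leaves-subtree f Tha (narrowerˡ h<a a<j width))
                                  (<⇒≤ h<i) i<a)
            (coord-dfsVector-subtree f Tha (narrowerˡ h<a a<j width) t h≤h′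
                                     (ends-within Tha Tij′ h<i i<a))
    byPosition (h<a , a<j , Tha , Taj , _) (tri> _ _ a<i) =
      trans (coord-dfsVector-right L R (<⇒≤ h<a) (leaves-subtree f Tha (narrowerˡ h<a a<j width)) a<i)
            (coord-dfsVector-subtree f Taj (narrowerʳ h<a a<j width) t
                                     (starts-within Th′i Taj a<i i<j) j′≤j)

  ψ-triangle : ∀ {h i j} → Triangle T h i j → ψ n T i ≡ (i ∸ h) * (j ∸ i)
  ψ-triangle t@(h<i , i<j , _ , _ , Thj) =
    coord-dfsVector-subtree n (outerEdge 1<n) (≤-trans pred[n]≤n (n≤1+n n)) t z≤n (<⇒≤pred j<n)
    where
    j<n : _ < n
    j<n = edge<n Thj
    1<n : 1 < n
    1<n = ≤-<-trans (≤-trans (s≤s z≤n) h<i) (<-trans i<j j<n)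

  beam-path : ∀ f {h i j} → Triangle T h i j →
              goRight n T (3 + f) i 0 0 ≡ seg i 0 h ∷ seg j h i ∷ goUp n T f i j
  beam-path f {h} {i} {j} (h<i , i<j , Thi , Tij , Thj) = begin
    goRight n T (3 + f) i 0 0                    ≡⟨ goRight-reflects (2 + f) {lo = 0} mirror-h-i ⟩
    seg i 0 h ∷ goUp n T (2 + f) h i             ≡⟨ cong (seg i 0 h ∷_) (goUp-reflects (1 + f) mirror-h-j) ⟩
    seg i 0 h ∷ goRight n T (1 + f) j h (suc h)  ≡⟨ cong (seg i 0 h ∷_) (goRight-reflects f {lo = suc h} mirror-i-j) ⟩
    seg i 0 h ∷ seg j h i ∷ goUp n T f i j       ∎
    where
    open ≡-Reasoning
    j<n : j < n
    j<n = edge<n Thj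
    mirror-h-i : search (λ u → T u i) 0 i ≡ just h
    mirror-h-i = search-least _ 0 i Thi z≤n h<i
      (λ _ m<h → ≢true⇒≡false (λ Tmi → no-interleaving Tmi Thj m<h h<i i<j))
    mirror-h-j : search (λ v → T h v) (suc i) (n ∸ suc i) ≡ just j
    mirror-h-j = search-least _ (suc i) (n ∸ suc i) Thj i<j (within (<-trans i<j j<n) j<n)
      (λ i<m m<j → ≢true⇒≡false (λ Thm → no-interleaving Thm Tij h<i i<m m<j))
    mirror-i-j : search (λ u → T u j) (suc h) (j ∸ suc h) ≡ just i
    mirror-i-j = search-least _ (suc h) (j ∸ suc h) Tij h<i (within (<-trans h<i i<j) i<j)
      (λ h<m m<i → ≢true⇒≡false (λ Tmj → no-interleaving Thi Tmj h<m m<i i<j))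

  beamArea-triangle : ∀ f {h i j} → Triangle T h i j →
                      areaBelow n i (goRight n T (3 + f) i 0 0) ≡ (i ∸ h) * (j ∸ i)
  beamArea-triangle f {h} {i} {j} t@(_ , _ , _ , _ , Thj) = begin
    areaBelow n i (goRight n T (3 + f) i 0 0)
      ≡⟨ cong (areaBelow n i) (beam-path f t) ⟩
    (h ⊓ i) * ((i ⊓ (n ∸ 1)) ∸ i) + (((i ⊓ i) ∸ h) * ((j ⊓ (n ∸ 1)) ∸ i) + areaBelow n i (goUp n T f i j))
      ≡⟨ cong₂ _+_ (cong ((h ⊓ i) *_) (m≤n⇒m∸n≡0 (m⊓n≤m i (n ∸ 1))))
                   (cong₂ _+_ (cong₂ _*_ (cong (_∸ h) (⊓-idem i))
                                         (cong (_∸ i) (m≤n⇒m⊓n≡m (<⇒≤pred (edge<n Thj)))))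
                              (areaBelow-goUp-beyond f ≤-refl)) ⟩
    (h ⊓ i) * 0 + ((i ∸ h) * (j ∸ i) + 0)
      ≡⟨ cong₂ _+_ (*-zeroʳ (h ⊓ i)) (+-identityʳ _) ⟩
    (i ∸ h) * (j ∸ i) ∎
    where open ≡-Reasoning

mainTheorem11 : (n : ℕ) → 3 ≤ n → (T : Edges) → IsTriangulation n T →
    (i : ℕ) → 1 ≤ i → i ≤ n ∸ 2 →
      (∃₂ λ h j → Triangle T h i j)
      × (∀ h j h′ j′ → Triangle T h i j → Triangle T h′ i j′ → h ≡ h′ × j ≡ j′)
      × (∀ h j → Triangle T h i j → ψ n T i ≡ (i ∸ h) * (j ∸ i))
      × ψ n T i ≡ beamArea n T i
mainTheorem11 n (s≤s (s≤s (s≤s _))) T tr i 1≤i i≤n∸2 =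
  triangle , (λ _ _ _ _ → middle-unique) , (λ _ _ → ψ-triangle) , ψ≡beamArea
  where
  open TriangulationProperties tr
  triangle : ∃₂ λ h j → Triangle T h i j
  triangle = middle-exists 1≤i (s≤s i≤n∸2)
  ψ≡beamArea : ψ n T i ≡ beamArea n T i
  ψ≡beamArea with triangle
  ... | _ , _ , t = trans (ψ-triangle t) (sym (beamArea-triangle _ t))
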